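{- The Almkvist--Zudilin numbers $$Z(n)=\sum_{k=0}^{n}(-1)^k3^{n-3k}\binom{n}{3k}\binom{n+k}{n}\frac{(3k)!}{k!^3}\qquad(n\ge0)$$ satisfy $Z(n)\equiv1\pmod 8$ if $n$ is even and $Z(n)\equiv3\pmod8$ if $n$ is odd.
   Context: Terms with $3k>n$ vanish since $\binom{n}{3k}=0$ there. -}

module Defs where

open import Data.Nat as ℕ using (ℕ; zero; suc; _∸_; _!)
open import Data.Nat.Combinatorics using (_C_)
open import Data.Nat.Properties using (m^n≢0; _!≢0)
open import Data.Integer as ℤ using (ℤ; +_)
open import Data.List using (List; map; upTo; foldr)

sgn : ℕ → ℤ
sgn zero = + 1
sgn (suc k) = ℤ.- sgn k

-- (3k)! / (k!)^3 : an exact (multinomial) integer, computed by ℕ division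
trinom : ℕ → ℕ
trinom k = ℕ._/_ ((3 ℕ.* k) !) ((k !) ℕ.^ 3) {{m^n≢0 (k !) 3 {{k !≢0}}}}

-- k-th summand; when 3k > n the factor (n C 3k) is 0, so truncated 3^(n ∸ 3k) is harmless
term : ℕ → ℕ → ℤ
term n k = sgn k ℤ.* (+ (3 ℕ.^ (n ∸ 3 ℕ.* k) ℕ.* (n C (3 ℕ.* k)) ℕ.* ((n ℕ.+ k) C n) ℕ.* trinom k))

Z : ℕ → ℤ
Z n = foldr ℤ._+_ (+ 0) (map (term n) (upTo (suc n)))

-- For k ≥ 1 the k-th summand of Z(n) is, up to sign and a power of 3, the multinomial coefficient
-- (n+k)! / ((n-3k)! k!⁴) = C(n+k,4k) C(4k,2k) C(2k,k)², and central binomial coefficients are even.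
-- Hence Z(n) ≡ 3ⁿ (mod 8), and 3²ᵐ = 9ᵐ ≡ 1 (mod 8).

module Submission where

open import Defs
open import Data.Nat using (ℕ; _*_; suc)
open import Data.Integer using (+_; _-_)
open import Data.Integer.Divisibility using (_∣_)
open import Data.Product using (_×_)

open import Data.Nat as ℕ using (zero; _+_; _!; _^_; _≤?_; NonZero)
open import Data.Nat.Properties
  using (+-identityʳ; *-comm; ^-*-assoc; *-cancelʳ-≡; m≤m+n; m+n∸m≡n; m+[n∸m]≡n; ≰⇒>; m*n≢0; m^n≢0; _!≢0)
open import Data.Nat.Combinatorics
  using (_C_; nCk≡nC[n∸k]; nCk≡n!/k![n-k]!; k![n∸k]!∣n!; nCk+nC[k+1]≡[n+1]C[k+1]; k>n⇒nCk≡0; nCn≡1)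
open import Data.Nat.DivMod using (m/n*n≡m; m*n/n≡m; /-congˡ)
open import Data.Nat.Divisibility as ℕ using (divides; _∣0; ∣n⇒∣m*n; *-pres-∣)
open import Data.Nat.Tactic.RingSolver using (solve-∀)
open import Data.Integer as ℤ using (0ℤ; 1ℤ)
import Data.Integer.Properties as ℤ
open import Data.Integer.Divisibility.Signed as Signed using (∣ᵤ⇒∣; ∣⇒∣ᵤ)
import Data.Integer.Tactic.RingSolver as ℤ
open import Data.List using (foldr; map; applyUpTo)
open import Data.List.Relation.Unary.All using (All; []; _∷_)
open import Data.List.Relation.Unary.All.Properties using (map⁺; applyUpTo⁺₂)
open import Data.Product using (_,_)
open import Function using (_$_)
open import Relation.Binary.PropositionalEquality using (_≡_; refl; sym; trans; cong; subst; module ≡-Reasoning)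
open import Relation.Nullary using (yes; no)
open ≡-Reasoning

k+k≡2*k : ∀ k → k + k ≡ 2 * k
k+k≡2*k k = cong (λ i → k + i) (sym (+-identityʳ k))

nCm*[m!*r!]≡n! : ∀ {n} m r → m + r ≡ n → (n C m) * (m ! * r !) ≡ n !
nCm*[m!*r!]≡n! m r refl = begin
  ((m + r) C m) * (m ! * r !)                 ≡⟨ cong (λ i → ((m + r) C m) * (m ! * i !)) (m+n∸m≡n m r) ⟨
  ((m + r) C m) * (m ! * (m + r ℕ.∸ m) !)     ≡⟨ cong (_* (m ! * (m + r ℕ.∸ m) !)) (nCk≡n!/k![n-k]! m≤m+r) ⟩
  (m + r) ! ℕ./ (m ! * (m + r ℕ.∸ m) !) * (m ! * (m + r ℕ.∸ m) !)
                                               ≡⟨ m/n*n≡m (k![n∸k]!∣n! m≤m+r) ⟩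
  (m + r) !                                   ∎
  where
  m≤m+r = m≤m+n m r
  instance _ = m*n≢0 (m !) ((m + r ℕ.∸ m) !) {{m !≢0}} {{(m + r ℕ.∸ m) !≢0}}

[2k]Ck-even : ∀ k → .{{NonZero k}} → 2 ℕ.∣ (2 * k) C k
[2k]Ck-even (suc k) = divides X $ begin
  (2 * suc k) C suc k ≡⟨ cong (λ i → suc (k + i) C suc k) (+-identityʳ (suc k)) ⟩
  suc n C suc k       ≡⟨ nCk+nC[k+1]≡[n+1]C[k+1] n k ⟨
  n C k + X           ≡⟨ cong (_+ X) (nCk≡nC[n∸k] (m≤m+n k (suc k))) ⟩
  n C (n ℕ.∸ k) + X   ≡⟨ cong (λ i → n C i + X) (m+n∸m≡n k (suc k)) ⟩
  X + X               ≡⟨ cong (λ i → X + i) (+-identityʳ X) ⟨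
  2 * X               ≡⟨ *-comm 2 X ⟩
  X * 2               ∎
  where
  n = k + suc k
  X = n C suc k

[3k]!≡[3kCk]*[2kCk]*k!^3 : ∀ k → (3 * k) ! ≡ ((3 * k) C k) * ((2 * k) C k) * (k !) ^ 3
[3k]!≡[3kCk]*[2kCk]*k!^3 k = begin
  (3 * k) !                     ≡⟨ nCm*[m!*r!]≡n! k (2 * k) refl ⟨
  c * (a * (2 * k) !)           ≡⟨ cong (λ i → c * (a * i)) (nCm*[m!*r!]≡n! k k (k+k≡2*k k)) ⟨
  c * (a * (e * (a * a)))       ≡⟨ rearrange c e a ⟩
  c * e * a ^ 3                 ∎
  where
  c = (3 * k) C k
  e = (2 * k) C k
  a = k !
  rearrange : ∀ c e a → c * (a * (e * (a * a))) ≡ c * e * (a * (a * (a * 1)))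
  rearrange = solve-∀

trinom≡[3kCk]*[2kCk] : ∀ k → trinom k ≡ ((3 * k) C k) * ((2 * k) C k)
trinom≡[3kCk]*[2kCk] k = begin
  (3 * k) ! ℕ./ (k !) ^ 3                                  ≡⟨ /-congˡ ([3k]!≡[3kCk]*[2kCk]*k!^3 k) ⟩
  ((3 * k) C k) * ((2 * k) C k) * (k !) ^ 3 ℕ./ (k !) ^ 3  ≡⟨ m*n/n≡m _ ((k !) ^ 3) ⟩
  ((3 * k) C k) * ((2 * k) C k)                            ∎
  where instance _ = m^n≢0 (k !) 3 {{k !≢0}}

[nC3k]*[n+kCn]*trinom≡[n+kC4k]*[4kC2k]*[2kCk]² : ∀ {n} k r → 3 * k + r ≡ n →
  (n C (3 * k)) * ((n + k) C n) * trinom k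
    ≡ ((n + k) C (2 * (2 * k))) * (((2 * (2 * k)) C (2 * k)) * (((2 * k) C k) * ((2 * k) C k)))
[nC3k]*[n+kCn]*trinom≡[n+kC4k]*[4kC2k]*[2kCk]² {n} k r refl = *-cancelʳ-≡ _ _ w (trans (sym lhs) rhs)
  where
  A = n C (3 * k)
  B = (n + k) C n
  C′ = (3 * k) C k
  D = (2 * (2 * k)) C (2 * k)
  E = (2 * k) C k
  F = (n + k) C (2 * (2 * k))
  a = k !
  e = r !
  w = a ^ 4 * e
  instance _ = m*n≢0 (a ^ 4) e {{m^n≢0 a 4 {{k !≢0}}}} {{r !≢0}}

  lhs : (n + k) ! ≡ A * B * trinom k * w
  lhs = begin
    (n + k) !                           ≡⟨ nCm*[m!*r!]≡n! n k refl ⟨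
    B * (n ! * a)                       ≡⟨ cong (λ i → B * (i * a)) (nCm*[m!*r!]≡n! (3 * k) r refl) ⟨
    B * (A * ((3 * k) ! * e) * a)       ≡⟨ cong (λ i → B * (A * (i * e) * a)) ([3k]!≡[3kCk]*[2kCk]*k!^3 k) ⟩
    B * (A * (C′ * E * a ^ 3 * e) * a)  ≡⟨ rearrange A B C′ E a e ⟩
    A * B * (C′ * E) * w                ≡⟨ cong (λ i → A * B * i * w) (trinom≡[3kCk]*[2kCk] k) ⟨
    A * B * trinom k * w                ∎
    where
    rearrange : ∀ A B C′ E a e → B * (A * (C′ * E * (a * (a * (a * 1))) * e) * a)
                                   ≡ A * B * (C′ * E) * (a * (a * (a * (a * 1))) * e)
    rearrange = solve-∀

  rhs : (n + k) ! ≡ F * (D * (E * E)) * w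
  rhs = begin
    (n + k) !                                     ≡⟨ nCm*[m!*r!]≡n! (2 * (2 * k)) r (4k+r≡3k+r+k k r) ⟨
    F * ((2 * (2 * k)) ! * e)                     ≡⟨ cong (λ i → F * (i * e)) (nCm*[m!*r!]≡n! (2 * k) (2 * k) (k+k≡2*k (2 * k))) ⟨
    F * (D * ((2 * k) ! * (2 * k) !) * e)         ≡⟨ cong (λ i → F * (D * (i * i) * e)) (nCm*[m!*r!]≡n! k k (k+k≡2*k k)) ⟨
    F * (D * (E * (a * a) * (E * (a * a))) * e)   ≡⟨ rearrange F D E a e ⟩
    F * (D * (E * E)) * w                         ∎
    where
    4k+r≡3k+r+k : ∀ k r → 2 * (2 * k) + r ≡ 3 * k + r + k
    4k+r≡3k+r+k = solve-∀
    rearrange : ∀ F D E a e → F * (D * (E * (a * a) * (E * (a * a))) * e)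
                                ≡ F * (D * (E * E)) * (a * (a * (a * (a * 1))) * e)
    rearrange = solve-∀

8∣[nC3k]*[n+kCn]*trinom : ∀ n k → .{{NonZero k}} → 8 ℕ.∣ (n C (3 * k)) * ((n + k) C n) * trinom k
8∣[nC3k]*[n+kCn]*trinom n k with 3 * k ≤? n
... | yes 3k≤n = subst (8 ℕ.∣_) (sym factorisation) (∣n⇒∣m*n ((n + k) C (2 * (2 * k))) 8∣D*E*E)
  where
  factorisation = [nC3k]*[n+kCn]*trinom≡[n+kC4k]*[4kC2k]*[2kCk]² k (n ℕ.∸ 3 * k) (m+[n∸m]≡n 3k≤n)
  instance _ = m*n≢0 2 k
  8∣D*E*E : 8 ℕ.∣ ((2 * (2 * k)) C (2 * k)) * (((2 * k) C k) * ((2 * k) C k))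
  8∣D*E*E = *-pres-∣ ([2k]Ck-even (2 * k)) (*-pres-∣ ([2k]Ck-even k) ([2k]Ck-even k))
... | no 3k≰n = subst (λ i → 8 ℕ.∣ i * ((n + k) C n) * trinom k) (sym (k>n⇒nCk≡0 (≰⇒> 3k≰n))) (8 ∣0)

∣-sum : ∀ {d xs} → All (d Signed.∣_) xs → d Signed.∣ foldr ℤ._+_ 0ℤ xs
∣-sum []           = Signed.divides 0ℤ refl
∣-sum (d∣x ∷ d∣xs) = Signed.∣m∣n⇒∣m+n d∣x (∣-sum d∣xs)

∣-diff-trans : ∀ {d} x y z → d Signed.∣ x - y → d Signed.∣ y - z → d Signed.∣ x - z
∣-diff-trans {d} x y z d∣x-y d∣y-z = subst (d Signed.∣_) (telescope x y z) (Signed.∣m∣n⇒∣m+n d∣x-y d∣y-z)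
  where
  telescope : ∀ x y z → x - y ℤ.+ (y - z) ≡ x - z
  telescope = ℤ.solve-∀

[a-1]∣[a^m-1] : ∀ a m → + a - 1ℤ Signed.∣ + (a ^ m) - 1ℤ
[a-1]∣[a^m-1] a zero    = Signed.divides 0ℤ refl
[a-1]∣[a^m-1] a (suc m) = subst (+ a - 1ℤ Signed.∣_) a*[a^m-1]+[a-1]≡a^[1+m]-1
  (Signed.∣m∣n⇒∣m+n (Signed.∣n⇒∣m*n (+ a) ([a-1]∣[a^m-1] a m)) Signed.∣-refl)
  where
  a*[a^m-1]+[a-1]≡a^[1+m]-1 : + a ℤ.* (+ (a ^ m) - 1ℤ) ℤ.+ (+ a - 1ℤ) ≡ + (a ^ suc m) - 1ℤ
  a*[a^m-1]+[a-1]≡a^[1+m]-1 = begin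
    + a ℤ.* (+ (a ^ m) - 1ℤ) ℤ.+ (+ a - 1ℤ) ≡⟨ telescope (+ a) (+ (a ^ m)) ⟩
    + a ℤ.* + (a ^ m) - 1ℤ                 ≡⟨ cong (_- 1ℤ) (ℤ.pos-* a (a ^ m)) ⟨
    + (a ^ suc m) - 1ℤ                     ∎
    where
    telescope : ∀ x y → x ℤ.* (y - 1ℤ) ℤ.+ (x - 1ℤ) ≡ x ℤ.* y - 1ℤ
    telescope = ℤ.solve-∀

term-zero : ∀ n → term n 0 ≡ + (3 ^ n)
term-zero n = begin
  term n 0                            ≡⟨ ℤ.*-identityˡ _ ⟩
  + (3 ^ n * 1 * ((n + 0) C n) * 1)   ≡⟨ cong (λ i → + (3 ^ n * 1 * (i C n) * 1)) (+-identityʳ n) ⟩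
  + (3 ^ n * 1 * (n C n) * 1)         ≡⟨ cong (λ i → + (3 ^ n * 1 * i * 1)) (nCn≡1 n) ⟩
  + (3 ^ n * 1 * 1 * 1)               ≡⟨ cong +_ (x*1*1*1≡x (3 ^ n)) ⟩
  + (3 ^ n)                           ∎
  where
  x*1*1*1≡x : ∀ x → x * 1 * 1 * 1 ≡ x
  x*1*1*1≡x = solve-∀

8∣term : ∀ n k → .{{NonZero k}} → + 8 Signed.∣ term n k
8∣term n k = Signed.∣n⇒∣m*n (sgn k) (∣ᵤ⇒∣ (subst (8 ℕ.∣_) (*-assoc-4 p _ _ _)
  (∣n⇒∣m*n p (8∣[nC3k]*[n+kCn]*trinom n k))))
  where
  p = 3 ^ (n ℕ.∸ 3 * k)
  *-assoc-4 : ∀ p a b c → p * (a * b * c) ≡ p * a * b * c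
  *-assoc-4 = solve-∀

Z≡3^n[mod8] : ∀ n → + 8 Signed.∣ Z n - + (3 ^ n)
Z≡3^n[mod8] n = subst (+ 8 Signed.∣_) tail≡Z-3^n (∣-sum (map⁺ (applyUpTo⁺₂ suc n (λ k → 8∣term n (suc k)))))
  where
  tail = foldr ℤ._+_ 0ℤ (map (term n) (applyUpTo suc n))
  tail≡Z-3^n : tail ≡ Z n - + (3 ^ n)
  tail≡Z-3^n = begin
    tail                            ≡⟨ x+y-x≡y (+ (3 ^ n)) tail ⟨
    + (3 ^ n) ℤ.+ tail - + (3 ^ n)  ≡⟨ cong (λ i → i ℤ.+ tail - + (3 ^ n)) (term-zero n) ⟨
    Z n - + (3 ^ n)                 ∎
    where
    x+y-x≡y : ∀ x y → x ℤ.+ y - x ≡ y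
    x+y-x≡y = ℤ.solve-∀

3^[2m]≡1[mod8] : ∀ m → + 8 Signed.∣ + (3 ^ (2 * m)) - 1ℤ
3^[2m]≡1[mod8] m = subst (λ i → + 8 Signed.∣ + i - 1ℤ) (^-*-assoc 3 2 m) ([a-1]∣[a^m-1] 9 m)

3^[2m+1]≡3[mod8] : ∀ m → + 8 Signed.∣ + (3 ^ suc (2 * m)) - + 3
3^[2m+1]≡3[mod8] m = subst (+ 8 Signed.∣_) 3*[3^[2m]-1]≡3^[2m+1]-3 (Signed.∣n⇒∣m*n (+ 3) (3^[2m]≡1[mod8] m))
  where
  3*[3^[2m]-1]≡3^[2m+1]-3 : + 3 ℤ.* (+ (3 ^ (2 * m)) - 1ℤ) ≡ + (3 ^ suc (2 * m)) - + 3
  3*[3^[2m]-1]≡3^[2m+1]-3 = begin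
    + 3 ℤ.* (+ (3 ^ (2 * m)) - 1ℤ)   ≡⟨ distrib (+ (3 ^ (2 * m))) ⟩
    + 3 ℤ.* + (3 ^ (2 * m)) - + 3    ≡⟨ cong (_- + 3) (ℤ.pos-* 3 (3 ^ (2 * m))) ⟨
    + (3 ^ suc (2 * m)) - + 3        ∎
    where
    distrib : ∀ x → + 3 ℤ.* (x - 1ℤ) ≡ + 3 ℤ.* x - + 3
    distrib = ℤ.solve-∀

Z≡c[mod8] : ∀ n c → + 8 Signed.∣ + (3 ^ n) - c → + 8 ∣ Z n - c
Z≡c[mod8] n c 8∣3^n-c = ∣⇒∣ᵤ (∣-diff-trans (Z n) (+ (3 ^ n)) c (Z≡3^n[mod8] n) 8∣3^n-c)

theorem5p3 : (m : ℕ) → ((+ 8) ∣ (Z (2 * m) - + 1)) × ((+ 8) ∣ (Z (suc (2 * m)) - + 3))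
theorem5p3 m = Z≡c[mod8] (2 * m) (+ 1) (3^[2m]≡1[mod8] m)
             , Z≡c[mod8] (suc (2 * m)) (+ 3) (3^[2m+1]≡3[mod8] m)
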